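{- For an MDSC instance $(E,\mathcal S,c,r)$, the optimal value $opt_{LP_1}$ of the linear program $$\min \sum_{S\in\mathcal S}c_Sx_S\ \text{ s.t. }\ \sum_{e\in E}y_e=1;\ \ \sum_{Q\in\Omega_e}l_Q\ge y_e\ (e\in E);\ \ x_S\ge\sum_{Q\colon S\in Q\in\Omega_e}l_Q\ (e\in E,\ S\in\mathcal S);\ \ x,y,l\ge 0$$ satisfies $opt_{LP_1}\le opt_{MDSC}$, where $opt_{MDSC}$ is the optimal value of the integer program $$\min \frac{\sum_{S\in\mathcal S}c_Sx_S}{\sum_{e\in E}y_e}\ \text{ s.t. }\ \sum_{Q\in\Omega_e}l_Q\ge y_e\ (e\in E);\ \ x_S\ge\sum_{Q\colon S\in Q\in\Omega_e}l_Q\ (e\in E,\ S\in\mathcal S);\ \ x_S,y_e,l_Q\in\{0,1\}.$$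
   Context: An MDSC instance $(E,\mathcal S,c,r)$: finite element set $E$, collection $\mathcal S\subseteq 2^E$, costs $c_S\ge0$, positive integer requirements $r_e$. For $e\in E$, an $r_e$-cover-set is a sub-collection $Q\subseteq\mathcal S$ with $|Q|=r_e$ all of whose sets contain $e$; $\Omega_e$ is the family of all $r_e$-cover-sets, and cover-sets in different families $\Omega_e$ are treated as distinct (each has its own variable $l_Q$) even if they consist of the same sets. The integer program is taken over solutions with $\sum_e y_e>0$.
   Formalization: The costs $c_S$ are nonnegative rationals, and the feasible point of the linear program is taken with rational values of $x$, $y$ and $l_Q$. -}

module Defs where

open import Data.Nat as ℕ using (ℕ; zero; suc)
open import Data.Bool using (Bool; true; false)
open import Data.Fin using (Fin)
open import Data.Fin.Subset using (Subset; _∈_; ∣_∣; inside; outside)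
open import Data.Fin.Subset.Properties using (_∈?_)
open import Data.Fin.Properties using (all?)
open import Data.List using (List; []; _∷_; map; _++_; filter; foldr)
open import Data.List as List using ()
open import Data.Vec using (Vec; []; _∷_)
open import Data.Product using (_×_; _,_)
open import Data.Sum using (_⊎_)
open import Data.Rational using (ℚ; 0ℚ; 1ℚ; _+_; _*_; _≤_)
open import Relation.Binary.PropositionalEquality using (_≡_)
open import Relation.Nullary using (Dec)
open import Relation.Nullary.Decidable using (_×-dec_; _→-dec_)
open import Function using (Injective)

sumℚ : List ℚ → ℚ
sumℚ = foldr _+_ 0ℚ

Σfin : ∀ {k} → (Fin k → ℚ) → ℚ
Σfin f = sumℚ (map f (List.allFin _))

allSubsets : ∀ k → List (Subset k)
allSubsets zero = [] ∷ []
allSubsets (suc k) = map (inside ∷_) (allSubsets k) ++ map (outside ∷_) (allSubsets k)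

-- An MDSC instance: E = Fin n, the collection S is indexed by Fin m
-- (sets i ⊆ E, pairwise distinct), costs c ≥ 0, requirements r ≥ 1.
record MDSC : Set where
  field
    n m   : ℕ
    sets  : Fin m → Subset n
    sets-distinct : Injective _≡_ _≡_ sets
    cost  : Fin m → ℚ
    cost≥0 : ∀ S → 0ℚ ≤ cost S
    req   : Fin n → ℕ
    req>0 : ∀ e → 1 ℕ.≤ req e

  -- Q ∈ Ω_e : Q is a sub-collection (subset of indices) with |Q| = r_e,
  -- all of whose sets contain e.
  InΩ : Fin n → Subset m → Set
  InΩ e Q = (∣ Q ∣ ≡ req e) × (∀ S → S ∈ Q → e ∈ sets S)

  InΩ? : ∀ e Q → Dec (InΩ e Q)
  InΩ? e Q = (∣ Q ∣ ℕ.≟ req e) ×-dec all? (λ S → (S ∈? Q) →-dec (e ∈? sets S))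

  Ω : Fin n → List (Subset m)
  Ω e = filter (InΩ? e) (allSubsets m)

  ΩS : Fin n → Fin m → List (Subset m)
  ΩS e S = filter (S ∈?_) (Ω e)

  -- Variables: x : Fin m → ℚ, y : Fin n → ℚ, l : Fin n → Subset m → ℚ,
  -- where l e Q is the variable l_Q for Q ∈ Ω_e (values for Q ∉ Ω_e unused).
  objective : (Fin m → ℚ) → ℚ
  objective x = Σfin (λ S → cost S * x S)

  CoverConstr : (Fin n → ℚ) → (Fin n → Subset m → ℚ) → Set
  CoverConstr y l = ∀ e → y e ≤ sumℚ (map (l e) (Ω e))

  LoadConstr : (Fin m → ℚ) → (Fin n → Subset m → ℚ) → Set
  LoadConstr x l = ∀ e S → sumℚ (map (l e) (ΩS e S)) ≤ x S

  LP1Feasible : (Fin m → ℚ) → (Fin n → ℚ) → (Fin n → Subset m → ℚ) → Set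
  LP1Feasible x y l =
    (Σfin y ≡ 1ℚ) × CoverConstr y l × LoadConstr x l
    × (∀ S → 0ℚ ≤ x S) × (∀ e → 0ℚ ≤ y e) × (∀ e Q → InΩ e Q → 0ℚ ≤ l e Q)

  IsBinary : ℚ → Set
  IsBinary q = (q ≡ 0ℚ) ⊎ (q ≡ 1ℚ)

  -- feasibility for the MDSC integer program (sum y > 0 is imposed separately)
  IPFeasible : (Fin m → ℚ) → (Fin n → ℚ) → (Fin n → Subset m → ℚ) → Set
  IPFeasible x y l =
    CoverConstr y l × LoadConstr x l
    × (∀ S → IsBinary (x S)) × (∀ e → IsBinary (y e)) × (∀ e Q → InΩ e Q → IsBinary (l e Q))

-- Scaling an integral solution (x, y, l) by t = 1 / Σ y keeps every covering and
-- load constraint (they are homogeneous and t ≥ 0), makes Σ y equal to 1, and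
-- turns the objective c·x into exactly the ratio (c·x) / Σ y.
module Submission where

open import Defs
open import Data.Fin using (Fin)
open import Data.Fin.Subset using (Subset)
open import Data.List using (List; []; _∷_; map; allFin)
open import Data.List.Properties using (map-cong)
open import Data.Product using (Σ; _×_; _,_)
open import Data.Rational
  using (ℚ; 0ℚ; 1ℚ; _<_; _≤_; _÷_; _*_; _+_; 1/_; positive; NonNegative; NonZero; Positive)
open import Data.Rational.Properties
open import Data.Sum using (_⊎_; inj₁; inj₂)
open import Relation.Binary.PropositionalEquality
open ≡-Reasoning

_·ᶠ_ : {A : Set} → ℚ → (A → ℚ) → A → ℚ
(t ·ᶠ f) a = t * f a

sumℚ-map-*ˡ : {A : Set} (t : ℚ) (f : A → ℚ) (xs : List A) →
  sumℚ (map (t ·ᶠ f) xs) ≡ t * sumℚ (map f xs)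
sumℚ-map-*ˡ t f []       = sym (*-zeroʳ t)
sumℚ-map-*ˡ t f (a ∷ xs) = begin
  t * f a + sumℚ (map (t ·ᶠ f) xs)  ≡⟨ cong (t * f a +_) (sumℚ-map-*ˡ t f xs) ⟩
  t * f a + t * sumℚ (map f xs)     ≡⟨ *-distribˡ-+ t (f a) _ ⟨
  t * (f a + sumℚ (map f xs))       ∎

Σfin-*ˡ : ∀ {k} (t : ℚ) (f : Fin k → ℚ) → Σfin (t ·ᶠ f) ≡ t * Σfin f
Σfin-*ˡ t f = sumℚ-map-*ˡ t f (allFin _)

binary⇒nonNeg : ∀ {q} → (q ≡ 0ℚ) ⊎ (q ≡ 1ℚ) → 0ℚ ≤ q
binary⇒nonNeg (inj₁ refl) = ≤-refl
binary⇒nonNeg (inj₂ refl) = nonNegative⁻¹ 1ℚ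

*-nonNeg : ∀ t .{{_ : NonNegative t}} {q} → 0ℚ ≤ q → 0ℚ ≤ t * q
*-nonNeg t {q} 0≤q = subst (_≤ t * q) (*-zeroʳ t) (*-monoˡ-≤-nonNeg t 0≤q)

*-mono-sum≤ : ∀ t .{{_ : NonNegative t}} {A : Set} (f : A → ℚ) xs {q} →
  sumℚ (map f xs) ≤ q → sumℚ (map (t ·ᶠ f) xs) ≤ t * q
*-mono-sum≤ t f xs h = subst (_≤ _) (sym (sumℚ-map-*ˡ t f xs)) (*-monoˡ-≤-nonNeg t h)

*-mono-≤sum : ∀ t .{{_ : NonNegative t}} {A : Set} (f : A → ℚ) xs {q} →
  q ≤ sumℚ (map f xs) → t * q ≤ sumℚ (map (t ·ᶠ f) xs)
*-mono-≤sum t f xs h = subst (_ ≤_) (sym (sumℚ-map-*ˡ t f xs)) (*-monoˡ-≤-nonNeg t h)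

module _ (I : MDSC) where
  open MDSC I

  CoverConstr-*ˡ : ∀ t .{{_ : NonNegative t}} {y l} →
    CoverConstr y l → CoverConstr (t ·ᶠ y) (λ e → t ·ᶠ l e)
  CoverConstr-*ˡ t {l = l} cov e = *-mono-≤sum t (l e) (Ω e) (cov e)

  LoadConstr-*ˡ : ∀ t .{{_ : NonNegative t}} {x l} →
    LoadConstr x l → LoadConstr (t ·ᶠ x) (λ e → t ·ᶠ l e)
  LoadConstr-*ˡ t {l = l} load e S = *-mono-sum≤ t (l e) (ΩS e S) (load e S)

  objective-*ˡ : ∀ t x → objective (t ·ᶠ x) ≡ t * objective x
  objective-*ˡ t x = begin
    Σfin (λ S → cost S * (t * x S))  ≡⟨ cong sumℚ (map-cong cost-* (allFin m)) ⟩
    Σfin (t ·ᶠ (λ S → cost S * x S)) ≡⟨ Σfin-*ˡ t (λ S → cost S * x S) ⟩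
    t * objective x                  ∎
    where
    cost-* : ∀ S → cost S * (t * x S) ≡ t * (cost S * x S)
    cost-* S = begin
      cost S * (t * x S)  ≡⟨ *-assoc (cost S) t (x S) ⟨
      cost S * t * x S    ≡⟨ cong (_* x S) (*-comm (cost S) t) ⟩
      t * cost S * x S    ≡⟨ *-assoc t (cost S) (x S) ⟩
      t * (cost S * x S)  ∎

  IPFeasible⇒LP1Feasible-*ˡ : ∀ t .{{_ : NonNegative t}} {x y l} →
    IPFeasible x y l → t * Σfin y ≡ 1ℚ → LP1Feasible (t ·ᶠ x) (t ·ᶠ y) (λ e → t ·ᶠ l e)
  IPFeasible⇒LP1Feasible-*ˡ t {y = y} (cov , load , x-bin , y-bin , l-bin) tΣy≡1 =
      trans (Σfin-*ˡ t y) tΣy≡1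
    , CoverConstr-*ˡ t cov
    , LoadConstr-*ˡ t load
    , (λ S → *-nonNeg t (binary⇒nonNeg (x-bin S)))
    , (λ e → *-nonNeg t (binary⇒nonNeg (y-bin e)))
    , (λ e Q Q∈Ω → *-nonNeg t (binary⇒nonNeg (l-bin e Q Q∈Ω)))

lemma3 : (I : MDSC) → let open MDSC I in
    (x : Fin m → ℚ) (y : Fin n → ℚ) (l : Fin n → Subset m → ℚ) →
    IPFeasible x y l → (pos : 0ℚ < Σfin y) →
    Σ (Fin m → ℚ) λ x′ → Σ (Fin n → ℚ) λ y′ → Σ (Fin n → Subset m → ℚ) λ l′ →
    LP1Feasible x′ y′ l′ ×
    (objective x′ ≤ _÷_ (objective x) (Σfin y) {{pos⇒nonZero (Σfin y) {{positive pos}}}})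
lemma3 I x y l feasible pos =
    t ·ᶠ x , t ·ᶠ y , (λ e → t ·ᶠ l e)
  , IPFeasible⇒LP1Feasible-*ˡ I t feasible (*-inverseˡ (Σfin y))
  , ≤-reflexive (trans (objective-*ˡ I t x) (*-comm t (objective x)))
  where
  open MDSC I
  instance
    Σy-positive : Positive (Σfin y)
    Σy-positive = positive pos
    Σy-nonZero : NonZero (Σfin y)
    Σy-nonZero = pos⇒nonZero (Σfin y)
  t : ℚ
  t = 1/ Σfin y
  instance
    t-nonNeg : NonNegative t
    t-nonNeg = pos⇒nonNeg t {{1/pos⇒pos (Σfin y)}}
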